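{- (i) $\log_2 S(n)\ge \frac{2}{27}n^3-\frac19 n^2-\frac19 n$. (ii) For $n$ large enough, $$S(n)\ge S(n-1)\cdot 2^{(2n^2-5n+1)/9}\ge S(n-2)\cdot 2^{(4n^2-14n+9)/9}\ge S(n-3)\cdot 2^{(6n^2-27n+28)/9}.$$
   Context: A 3-graph on $[n]$ is a set of 3-subsets of $[n]$. It is semi-bipartite if there is an ordered partition $(X,Y)$ of $[n]$ such that every edge has exactly two vertices in $X$. $S(n)$ is the number of (labeled) semi-bipartite 3-graphs on vertex set $[n]$. -}

module Defs where

open import Data.Nat using (ℕ; zero; suc; _<ᵇ_; _≡ᵇ_)
open import Data.Bool using (Bool; true; false; _∧_; if_then_else_)
open import Data.Fin using (Fin; toℕ)
open import Data.List using (List; []; _∷_; _++_; map; concatMap; filterᵇ; length; allFin)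
open import Data.Bool.ListAction using (all; any)
open import Data.Vec using (Vec; []; _∷_; lookup)
open import Data.Product using (_×_; _,_)

-- A 3-subset {i,j,k} of [n] (vertices = Fin n) is represented uniquely
-- by the triple (i , j , k) with i < j < k.
Triple : ℕ → Set
Triple n = Fin n × Fin n × Fin n

triples : (n : ℕ) → List (Triple n)
triples n =
  concatMap (λ i → concatMap (λ j → concatMap (λ k →
      if (toℕ i <ᵇ toℕ j) ∧ (toℕ j <ᵇ toℕ k) then (i , j , k) ∷ [] else [])
    (allFin n)) (allFin n)) (allFin n)

sublists : {A : Set} → List A → List (List A)
sublists []       = [] ∷ []
sublists (x ∷ xs) = sublists xs ++ map (x ∷_) (sublists xs)

threeGraphs : (n : ℕ) → List (List (Triple n))
threeGraphs n = sublists (triples n)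

-- All vectors in Bool^n: a vector X encodes the ordered partition (X , Y)
-- of [n] with X = {v | X[v] = true} and Y = {v | X[v] = false}.
allVecs : (n : ℕ) → List (Vec Bool n)
allVecs zero    = [] ∷ []
allVecs (suc n) = map (true ∷_) (allVecs n) ++ map (false ∷_) (allVecs n)

b2n : Bool → ℕ
b2n true  = 1
b2n false = 0

exactlyTwoIn : {n : ℕ} → Vec Bool n → Triple n → Bool
exactlyTwoIn X (i , j , k) =
  (b2n (lookup X i) Data.Nat.+ b2n (lookup X j) Data.Nat.+ b2n (lookup X k)) ≡ᵇ 2

semiBipartite : {n : ℕ} → List (Triple n) → Bool
semiBipartite {n} H = any (λ X → all (exactlyTwoIn X) H) (allVecs n)

S : ℕ → ℕ
S n = length (filterᵇ semiBipartite (threeGraphs n))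

-- For an ordered partition (X, Y) with |X| = a and |Y| = f, every set of the C(a,2)·f triples meeting X in exactly
-- two vertices is semi-bipartite, so S(n) ≥ 2^(C(a,2)·f); taking a ≈ 2n/3 gives (i).
-- For (ii) call a partition good if |Y| ≤ 2|X|. A graph on [n] that is semi-bipartite for a good partition extends,
-- by putting the new vertex into X or into Y, to at least 2^E semi-bipartite graphs on [n+1], where
-- 9E ≥ 2n² − n − 1. The graphs having only bad partitions number at most 2ⁿ·2^(n³/18), which by (i) is at most
-- S(n)/16 once n ≥ 13. Hence S(n+1) ≥ 2^E·(15/16)·S(n), and (16/15)⁹ < 2 gives the first inequality of (ii);
-- the other two are the same inequality at n − 1 and n − 2, multiplied by powers of 2.

module Submission where

open import Defs
open import Data.Bool using (Bool; true; false; T; _∧_; _∨_; not; if_then_else_)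
open import Data.Bool.ListAction using (and; all; any)
open import Data.Bool.Properties using (∧-assoc; ∧-zeroʳ; ∨-zeroʳ)
open import Data.Fin using (Fin; toℕ; zero; suc)
open import Data.List using (List; []; _∷_; _++_; map; concat; concatMap; filterᵇ; length; allFin; tabulate)
open import Data.List.Membership.Propositional using (_∈_)
open import Data.List.Membership.Propositional.Properties using (∈-map⁺; ∈-++⁺ˡ; ∈-++⁺ʳ)
open import Data.List.Properties using (map-cong; map-++; map-∘; length-++; length-map; map-tabulate; concatMap-cong; map-concatMap; concatMap-pure)
open import Data.List.Relation.Unary.Any using (here; there)
open import Data.Nat using (ℕ; zero; suc; _+_; _*_; _∸_; _^_; _≤_; _<_; _≤ᵇ_; _<ᵇ_; _≡ᵇ_; z≤n; s≤s; NonZero; pred; _≤?_)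
open import Data.Nat.DivMod using (_/_; _%_; m≡m%n+[m/n]*n; m%n<n; m<n*o⇒m/o<n)
open import Data.Nat.ListAction using (sum)
open import Data.Nat.Properties
open import Algebra.Properties.CommutativeSemigroup +-commutativeSemigroup using () renaming (interchange to +-interchange)
open import Algebra.Properties.CommutativeSemigroup *-commutativeSemigroup using () renaming (interchange to *-interchange)
open import Data.Nat.Tactic.RingSolver using (solve-∀)
open import Data.Product using (_×_; _,_; ∃; ∃₂; proj₂)
open import Data.Sum using (_⊎_; inj₁; inj₂)
open import Data.Unit using (tt)
open import Data.Vec using (Vec; []; _∷_; lookup; toList; replicate) renaming (_++_ to _++ᵛ_)
open import Function using (_∘_; id)
open import Relation.Binary.PropositionalEquality
open import Relation.Nullary using (yes; no)

-- Counting with boolean predicates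

private variable
  A B : Set

countᵇ : (A → Bool) → List A → ℕ
countᵇ p xs = length (filterᵇ p xs)

countᵇ-∷ : (p : A → Bool) (x : A) (xs : List A) → countᵇ p (x ∷ xs) ≡ b2n (p x) + countᵇ p xs
countᵇ-∷ p x xs with p x
... | true  = refl
... | false = refl

countᵇ-++ : (p : A → Bool) (xs ys : List A) → countᵇ p (xs ++ ys) ≡ countᵇ p xs + countᵇ p ys
countᵇ-++ p []       ys = refl
countᵇ-++ p (x ∷ xs) ys = begin
  countᵇ p (x ∷ xs ++ ys)                   ≡⟨ countᵇ-∷ p x (xs ++ ys) ⟩
  b2n (p x) + countᵇ p (xs ++ ys)           ≡⟨ cong (b2n (p x) +_) (countᵇ-++ p xs ys) ⟩
  b2n (p x) + (countᵇ p xs + countᵇ p ys)   ≡⟨ +-assoc (b2n (p x)) _ _ ⟨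
  (b2n (p x) + countᵇ p xs) + countᵇ p ys   ≡⟨ cong (_+ countᵇ p ys) (countᵇ-∷ p x xs) ⟨
  countᵇ p (x ∷ xs) + countᵇ p ys           ∎
  where open ≡-Reasoning

countᵇ-map : (p : B → Bool) (f : A → B) (xs : List A) → countᵇ p (map f xs) ≡ countᵇ (p ∘ f) xs
countᵇ-map p f []       = refl
countᵇ-map p f (x ∷ xs) = trans (countᵇ-∷ p (f x) (map f xs))
  (trans (cong (b2n (p (f x)) +_) (countᵇ-map p f xs)) (sym (countᵇ-∷ (p ∘ f) x xs)))

countᵇ-cong : {p q : A → Bool} → (∀ x → p x ≡ q x) → (xs : List A) → countᵇ p xs ≡ countᵇ q xs
countᵇ-cong         p≗q []       = refl
countᵇ-cong {p = p} {q} p≗q (x ∷ xs) = trans (countᵇ-∷ p x xs)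
  (trans (cong₂ (λ b m → b2n b + m) (p≗q x) (countᵇ-cong p≗q xs)) (sym (countᵇ-∷ q x xs)))

countᵇ-const-false : (xs : List A) → countᵇ (λ _ → false) xs ≡ 0
countᵇ-const-false []       = refl
countᵇ-const-false (x ∷ xs) = countᵇ-const-false xs

countᵇ-mono : {p q : A → Bool} → (∀ x → p x ≡ true → q x ≡ true) → (xs : List A) → countᵇ p xs ≤ countᵇ q xs
countᵇ-mono                 p⇒q []       = z≤n
countᵇ-mono {p = p} {q = q} p⇒q (x ∷ xs)
  rewrite countᵇ-∷ p x xs | countᵇ-∷ q x xs = +-mono-≤ (b2n-mono (p x) (q x) (p⇒q x)) (countᵇ-mono p⇒q xs)
  where
  b2n-mono : ∀ a b → (a ≡ true → b ≡ true) → b2n a ≤ b2n b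
  b2n-mono true  b a⇒b rewrite a⇒b refl = ≤-refl
  b2n-mono false b a⇒b = z≤n

countᵇ-∨ : (p q : A → Bool) (xs : List A) → countᵇ (λ x → p x ∨ q x) xs ≤ countᵇ p xs + countᵇ q xs
countᵇ-∨ p q []       = z≤n
countᵇ-∨ p q (x ∷ xs)
  rewrite countᵇ-∷ (λ x → p x ∨ q x) x xs | countᵇ-∷ p x xs | countᵇ-∷ q x xs = begin
    b2n (p x ∨ q x) + countᵇ (λ x → p x ∨ q x) xs       ≤⟨ +-mono-≤ (b2n-∨ (p x) (q x)) (countᵇ-∨ p q xs) ⟩
    (b2n (p x) + b2n (q x)) + (countᵇ p xs + countᵇ q xs) ≡⟨ +-interchange (b2n (p x)) (b2n (q x)) (countᵇ p xs) (countᵇ q xs) ⟩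
    (b2n (p x) + countᵇ p xs) + (b2n (q x) + countᵇ q xs) ∎
  where
  open ≤-Reasoning
  b2n-∨ : ∀ a b → b2n (a ∨ b) ≤ b2n a + b2n b
  b2n-∨ true  b = s≤s z≤n
  b2n-∨ false b = ≤-refl

sum-map-+ : (f g : A → ℕ) (xs : List A) → sum (map (λ x → f x + g x) xs) ≡ sum (map f xs) + sum (map g xs)
sum-map-+ f g []       = refl
sum-map-+ f g (x ∷ xs) =
  trans (cong (f x + g x +_) (sum-map-+ f g xs)) (+-interchange (f x) (g x) (sum (map f xs)) (sum (map g xs)))

sum-map-≥ : (f : A → ℕ) (p : A → Bool) (c : ℕ) → (∀ x → p x ≡ true → c ≤ f x) →
            (xs : List A) → c * countᵇ p xs ≤ sum (map f xs)
sum-map-≥ f p c p⇒c≤f []       = ≤-reflexive (*-zeroʳ c)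
sum-map-≥ f p c p⇒c≤f (x ∷ xs) rewrite countᵇ-∷ p x xs with p x in px
... | true  = begin
  c * (1 + countᵇ p xs)     ≡⟨ *-distribˡ-+ c 1 (countᵇ p xs) ⟩
  c * 1 + c * countᵇ p xs   ≤⟨ +-mono-≤ (≤-trans (≤-reflexive (*-identityʳ c)) (p⇒c≤f x px)) (sum-map-≥ f p c p⇒c≤f xs) ⟩
  f x + sum (map f xs)      ∎
  where open ≤-Reasoning
... | false = ≤-trans (sum-map-≥ f p c p⇒c≤f xs) (m≤n+m _ (f x))

sum-map-≤ : (f : A → ℕ) (c : ℕ) → (∀ x → f x ≤ c) → (xs : List A) → sum (map f xs) ≤ length xs * c
sum-map-≤ f c f≤c []       = z≤n
sum-map-≤ f c f≤c (x ∷ xs) = +-mono-≤ (f≤c x) (sum-map-≤ f c f≤c xs)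

sublists-map : (f : A → B) (xs : List A) → sublists (map f xs) ≡ map (map f) (sublists xs)
sublists-map f []       = refl
sublists-map f (x ∷ xs) = begin
  sublists (map f xs) ++ map (f x ∷_) (sublists (map f xs))
    ≡⟨ cong (λ L → L ++ map (f x ∷_) L) (sublists-map f xs) ⟩
  map (map f) (sublists xs) ++ map (f x ∷_) (map (map f) (sublists xs))
    ≡⟨ cong (map (map f) (sublists xs) ++_) (trans (sym (map-∘ (sublists xs))) (map-∘ (sublists xs))) ⟩
  map (map f) (sublists xs) ++ map (map f) (map (x ∷_) (sublists xs))
    ≡⟨ map-++ (map f) (sublists xs) (map (x ∷_) (sublists xs)) ⟨
  map (map f) (sublists (x ∷ xs)) ∎
  where open ≡-Reasoning

countᵇ-all-sublists : (q : A → Bool) (xs : List A) → countᵇ (all q) (sublists xs) ≡ 2 ^ countᵇ q xs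
countᵇ-all-sublists q []       = refl
countᵇ-all-sublists q (x ∷ xs) = begin
  countᵇ (all q) (sublists xs ++ map (x ∷_) (sublists xs))
    ≡⟨ countᵇ-++ (all q) (sublists xs) (map (x ∷_) (sublists xs)) ⟩
  countᵇ (all q) (sublists xs) + countᵇ (all q) (map (x ∷_) (sublists xs))
    ≡⟨ cong₂ _+_ (countᵇ-all-sublists q xs) (countᵇ-map (all q) (x ∷_) (sublists xs)) ⟩
  2 ^ countᵇ q xs + countᵇ (λ C → q x ∧ all q C) (sublists xs)
    ≡⟨ extend (q x) ⟩
  2 ^ b2n (q x) * 2 ^ countᵇ q xs
    ≡⟨ ^-distribˡ-+-* 2 (b2n (q x)) (countᵇ q xs) ⟨
  2 ^ (b2n (q x) + countᵇ q xs)
    ≡⟨ cong (2 ^_) (countᵇ-∷ q x xs) ⟨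
  2 ^ countᵇ q (x ∷ xs) ∎
  where
  open ≡-Reasoning
  extend : ∀ b → 2 ^ countᵇ q xs + countᵇ (λ C → b ∧ all q C) (sublists xs) ≡ 2 ^ b2n b * 2 ^ countᵇ q xs
  extend true  = cong (2 ^ countᵇ q xs +_) (trans (countᵇ-all-sublists q xs) (sym (+-identityʳ _)))
  extend false = cong (2 ^ countᵇ q xs +_) (countᵇ-const-false (sublists xs))

countᵇ-sublists-++ : (p : List A → Bool) (xs ys : List A) →
  countᵇ p (sublists (xs ++ ys)) ≡ sum (map (λ B → countᵇ (λ C → p (C ++ B)) (sublists xs)) (sublists ys))
countᵇ-sublists-++ p []       ys = countᵇ-as-sum (sublists ys)
  where
  countᵇ-as-sum : (Bs : List _) → countᵇ p Bs ≡ sum (map (λ B → countᵇ (λ C → p (C ++ B)) ([] ∷ [])) Bs)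
  countᵇ-as-sum []       = refl
  countᵇ-as-sum (B ∷ Bs) = trans (countᵇ-∷ p B Bs)
    (cong₂ _+_ (sym (trans (countᵇ-∷ (λ C → p (C ++ B)) [] []) (+-identityʳ _))) (countᵇ-as-sum Bs))
countᵇ-sublists-++ p (x ∷ xs) ys = begin
  countᵇ p (sublists (xs ++ ys) ++ map (x ∷_) (sublists (xs ++ ys)))
    ≡⟨ countᵇ-++ p (sublists (xs ++ ys)) (map (x ∷_) (sublists (xs ++ ys))) ⟩
  countᵇ p (sublists (xs ++ ys)) + countᵇ p (map (x ∷_) (sublists (xs ++ ys)))
    ≡⟨ cong (countᵇ p (sublists (xs ++ ys)) +_) (countᵇ-map p (x ∷_) (sublists (xs ++ ys))) ⟩
  countᵇ p (sublists (xs ++ ys)) + countᵇ (p ∘ (x ∷_)) (sublists (xs ++ ys))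
    ≡⟨ cong₂ _+_ (countᵇ-sublists-++ p xs ys) (countᵇ-sublists-++ (p ∘ (x ∷_)) xs ys) ⟩
  sum (map (λ B → countᵇ (λ C → p (C ++ B)) (sublists xs)) (sublists ys))
    + sum (map (λ B → countᵇ (λ C → p (x ∷ C ++ B)) (sublists xs)) (sublists ys))
    ≡⟨ sum-map-+ _ _ (sublists ys) ⟨
  sum (map (λ B → countᵇ (λ C → p (C ++ B)) (sublists xs) + countᵇ (λ C → p (x ∷ C ++ B)) (sublists xs)) (sublists ys))
    ≡⟨ cong sum (map-cong split (sublists ys)) ⟩
  sum (map (λ B → countᵇ (λ C → p (C ++ B)) (sublists (x ∷ xs))) (sublists ys)) ∎
  where
  open ≡-Reasoning
  split : ∀ B → countᵇ (λ C → p (C ++ B)) (sublists xs) + countᵇ (λ C → p (x ∷ C ++ B)) (sublists xs)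
              ≡ countᵇ (λ C → p (C ++ B)) (sublists (x ∷ xs))
  split B = sym (trans (countᵇ-++ (λ C → p (C ++ B)) (sublists xs) (map (x ∷_) (sublists xs)))
                       (cong (countᵇ (λ C → p (C ++ B)) (sublists xs) +_) (countᵇ-map (λ C → p (C ++ B)) (x ∷_) (sublists xs))))

all-++ : (q : A → Bool) (xs ys : List A) → all q (xs ++ ys) ≡ all q xs ∧ all q ys
all-++ q []       ys = refl
all-++ q (x ∷ xs) ys = trans (cong (q x ∧_) (all-++ q xs ys)) (sym (∧-assoc (q x) (all q xs) (all q ys)))

any-∈ : {f : A → Bool} {x : A} {xs : List A} → x ∈ xs → f x ≡ true → any f xs ≡ true
any-∈ {f = f} {xs = x ∷ xs} (here refl)  fx = cong (_∨ any f xs) fx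
any-∈ {f = f} {xs = y ∷ ys} (there x∈ys) fx = trans (cong (f y ∨_) (any-∈ x∈ys fx)) (∨-zeroʳ (f y))

any-witness : (f : A → Bool) (xs : List A) → any f xs ≡ true → ∃ λ x → f x ≡ true
any-witness f (x ∷ xs) any≡true with f x in fx
... | true  = x , fx
... | false = any-witness f xs any≡true

any-split : (g f : A → Bool) (xs : List A) → any f xs ≡ true →
            any (λ x → g x ∧ f x) xs ∨ any (λ x → not (g x) ∧ f x) xs ≡ true
any-split g f (x ∷ xs) any≡true with f x | g x
... | true  | true  = refl
... | true  | false = ∨-zeroʳ _
... | false | true  = any-split g f xs any≡true
... | false | false = any-split g f xs any≡true

allVecs-complete : {n : ℕ} (X : Vec Bool n) → X ∈ allVecs n
allVecs-complete []          = here refl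
allVecs-complete (true ∷ X)  = ∈-++⁺ˡ (∈-map⁺ (true ∷_) (allVecs-complete X))
allVecs-complete (false ∷ X) = ∈-++⁺ʳ _ (∈-map⁺ (false ∷_) (allVecs-complete X))

length-allVecs : (n : ℕ) → length (allVecs n) ≡ 2 ^ n
length-allVecs zero    = refl
length-allVecs (suc n) = begin
  length (map (true ∷_) (allVecs n) ++ map (false ∷_) (allVecs n))
    ≡⟨ length-++ (map (true ∷_) (allVecs n)) ⟩
  length (map (true ∷_) (allVecs n)) + length (map (false ∷_) (allVecs n))
    ≡⟨ cong₂ _+_ (length-map (true ∷_) (allVecs n)) (length-map (false ∷_) (allVecs n)) ⟩
  length (allVecs n) + length (allVecs n)
    ≡⟨ cong (λ m → m + m) (length-allVecs n) ⟩
  2 ^ n + 2 ^ n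
    ≡⟨ cong (2 ^ n +_) (+-identityʳ (2 ^ n)) ⟨
  2 ^ suc n ∎
  where open ≡-Reasoning

-- The 3-subsets of [n+1]: those through the vertex 0 and the lifted ones

concatMap-allFin-suc : {n : ℕ} (f : Fin (suc n) → List A) →
  concatMap f (allFin (suc n)) ≡ f zero ++ concatMap (f ∘ suc) (allFin n)
concatMap-allFin-suc f =
  cong (f zero ++_) (trans (cong concat (map-tabulate suc f)) (sym (cong concat (map-tabulate id (f ∘ suc)))))

concatMap-allFin-lift : {n : ℕ} (f : Fin (suc n) → List B) {g : Fin n → List A} (h : A → B) →
  f zero ≡ [] → (∀ x → f (suc x) ≡ map h (g x)) → concatMap f (allFin (suc n)) ≡ map h (concatMap g (allFin n))
concatMap-allFin-lift {n = n} f {g} h f0≡[] f∘suc≡ = begin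
  concatMap f (allFin (suc n))              ≡⟨ concatMap-allFin-suc f ⟩
  f zero ++ concatMap (f ∘ suc) (allFin n)  ≡⟨ cong₂ _++_ f0≡[] (concatMap-cong f∘suc≡ (allFin n)) ⟩
  concatMap (map h ∘ g) (allFin n)          ≡⟨ map-concatMap h g (allFin n) ⟨
  map h (concatMap g (allFin n))            ∎
  where open ≡-Reasoning

concatMap-const-[] : (xs : List A) → concatMap {B = B} (λ _ → []) xs ≡ []
concatMap-const-[] []       = refl
concatMap-const-[] (x ∷ xs) = concatMap-const-[] xs

map-if-[_] : (f : A → B) (b : Bool) (x : A) → map f (if b then x ∷ [] else []) ≡ (if b then f x ∷ [] else [])
map-if-[ f ] true  x = refl
map-if-[ f ] false x = refl

Pair : ℕ → Set
Pair n = Fin n × Fin n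

pairIf : {n : ℕ} → Fin n → Fin n → List (Pair n)
pairIf j k = if toℕ j <ᵇ toℕ k then (j , k) ∷ [] else []

-- Enumerated like `triples`, so that triples-suc holds as an equality of lists.
pairs : (n : ℕ) → List (Pair n)
pairs n = concatMap (λ j → concatMap (pairIf j) (allFin n)) (allFin n)

tripleIf : {n : ℕ} → Fin n → Fin n → Fin n → List (Triple n)
tripleIf i j k = if (toℕ i <ᵇ toℕ j) ∧ (toℕ j <ᵇ toℕ k) then (i , j , k) ∷ [] else []

liftPair : {n : ℕ} → Pair n → Pair (suc n)
liftPair (j , k) = suc j , suc k

liftTriple : {n : ℕ} → Triple n → Triple (suc n)
liftTriple (i , j , k) = suc i , suc j , suc k

withZero : {n : ℕ} → Pair n → Triple (suc n)
withZero (j , k) = zero , suc j , suc k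

pairs-suc : (n : ℕ) → pairs (suc n) ≡ map (λ k → zero , suc k) (allFin n) ++ map liftPair (pairs n)
pairs-suc n = begin
  pairs (suc n)
    ≡⟨ concatMap-allFin-suc (λ j → concatMap (pairIf j) (allFin (suc n))) ⟩
  concatMap (pairIf zero) (allFin (suc n)) ++ concatMap (λ j → concatMap (pairIf (suc j)) (allFin (suc n))) (allFin n)
    ≡⟨ cong₂ _++_ fromZero (concatMap-cong fromSuc (allFin n)) ⟩
  map (λ k → zero , suc k) (allFin n) ++ concatMap (λ j → map liftPair (concatMap (pairIf j) (allFin n))) (allFin n)
    ≡⟨ cong (map (λ k → zero , suc k) (allFin n) ++_) (map-concatMap liftPair _ (allFin n)) ⟨
  map (λ k → zero , suc k) (allFin n) ++ map liftPair (pairs n) ∎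
  where
  open ≡-Reasoning
  fromZero : concatMap (pairIf zero) (allFin (suc n)) ≡ map (λ k → zero , suc k) (allFin n)
  fromZero = trans (concatMap-allFin-lift (pairIf zero) (λ k → zero , suc k) refl (λ k → refl)) (cong (map _) (concatMap-pure (allFin n)))
  fromSuc : ∀ j → concatMap (pairIf (suc j)) (allFin (suc n)) ≡ map liftPair (concatMap (pairIf j) (allFin n))
  fromSuc j = concatMap-allFin-lift (pairIf (suc j)) liftPair refl (λ k → sym (map-if-[ liftPair ] (toℕ j <ᵇ toℕ k) (j , k)))

triples-suc : (n : ℕ) → triples (suc n) ≡ map withZero (pairs n) ++ map liftTriple (triples n)
triples-suc n = begin
  triples (suc n)
    ≡⟨ concatMap-allFin-suc (λ i → concatMap (λ j → concatMap (tripleIf i j) (allFin (suc n))) (allFin (suc n))) ⟩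
  containingZero ++ concatMap (λ i → concatMap (λ j → concatMap (tripleIf (suc i) j) (allFin (suc n))) (allFin (suc n))) (allFin n)
    ≡⟨ cong₂ _++_ containingZero≡ (concatMap-cong avoidingZero≡ (allFin n)) ⟩
  map withZero (pairs n) ++ concatMap (λ i → map liftTriple (concatMap (λ j → concatMap (tripleIf i j) (allFin n)) (allFin n))) (allFin n)
    ≡⟨ cong (map withZero (pairs n) ++_) (map-concatMap liftTriple _ (allFin n)) ⟨
  map withZero (pairs n) ++ map liftTriple (triples n) ∎
  where
  open ≡-Reasoning
  containingZero : List (Triple (suc n))
  containingZero = concatMap (λ j → concatMap (tripleIf zero j) (allFin (suc n))) (allFin (suc n))
  containingZero≡ : containingZero ≡ map withZero (pairs n)
  containingZero≡ = concatMap-allFin-lift (λ j → concatMap (tripleIf zero j) (allFin (suc n))) withZero (concatMap-const-[] (allFin (suc n)))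
    (λ j → concatMap-allFin-lift (tripleIf zero (suc j)) withZero refl (λ k → sym (map-if-[ withZero ] (toℕ j <ᵇ toℕ k) (j , k))))
  lastSucZero : ∀ i j → tripleIf (suc i) (suc j) zero ≡ []
  lastSucZero i j rewrite ∧-zeroʳ (toℕ i <ᵇ toℕ j) = refl
  avoidingZero≡ : ∀ i → concatMap (λ j → concatMap (tripleIf (suc i) j) (allFin (suc n))) (allFin (suc n))
                      ≡ map liftTriple (concatMap (λ j → concatMap (tripleIf i j) (allFin n)) (allFin n))
  avoidingZero≡ i = concatMap-allFin-lift (λ j → concatMap (tripleIf (suc i) j) (allFin (suc n))) liftTriple (concatMap-const-[] (allFin (suc n)))
    (λ j → concatMap-allFin-lift (tripleIf (suc i) (suc j)) liftTriple (lastSucZero i j)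
      (λ k → sym (map-if-[ liftTriple ] ((toℕ i <ᵇ toℕ j) ∧ (toℕ j <ᵇ toℕ k)) (i , j , k))))

countᵇ-allFin-suc : {n : ℕ} (p : Fin (suc n) → Bool) → countᵇ p (allFin (suc n)) ≡ b2n (p zero) + countᵇ (p ∘ suc) (allFin n)
countᵇ-allFin-suc {n = n} p = trans (countᵇ-∷ p zero (tabulate suc))
  (cong (b2n (p zero) +_) (trans (cong (countᵇ p) (sym (map-tabulate id suc))) (countᵇ-map p suc (allFin n))))

trues : {n : ℕ} → Vec Bool n → ℕ
trues X = countᵇ id (toList X)

falses : {n : ℕ} → Vec Bool n → ℕ
falses X = countᵇ not (toList X)

trues+falses : {n : ℕ} (X : Vec Bool n) → trues X + falses X ≡ n
trues+falses []          = refl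
trues+falses (true ∷ X)  = cong suc (trues+falses X)
trues+falses (false ∷ X) = trans (+-suc (trues X) (falses X)) (cong suc (trues+falses X))

countᵇ-lookup : {n : ℕ} (g : Bool → Bool) (X : Vec Bool n) → countᵇ (g ∘ lookup X) (allFin n) ≡ countᵇ g (toList X)
countᵇ-lookup g []      = refl
countᵇ-lookup g (x ∷ X) = trans (countᵇ-allFin-suc (g ∘ lookup (x ∷ X)))
  (trans (cong (b2n (g x) +_) (countᵇ-lookup g X)) (sym (countᵇ-∷ g x (toList X))))

choose2 : ℕ → ℕ
choose2 zero    = 0
choose2 (suc a) = a + choose2 a

b2n≡ᵇ0 : ∀ b → (b2n b ≡ᵇ 0) ≡ not b
b2n≡ᵇ0 true  = refl
b2n≡ᵇ0 false = refl

b2n≡ᵇ1 : ∀ b → (b2n b ≡ᵇ 1) ≡ b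
b2n≡ᵇ1 true  = refl
b2n≡ᵇ1 false = refl

b2n≡ᵇ2 : ∀ b → (b2n b ≡ᵇ 2) ≡ false
b2n≡ᵇ2 true  = refl
b2n≡ᵇ2 false = refl

pairSum≡ᵇ : {n : ℕ} → Vec Bool n → ℕ → Pair n → Bool
pairSum≡ᵇ X c (j , k) = (b2n (lookup X j) + b2n (lookup X k)) ≡ᵇ c

countᵇ-pairSum≡ᵇ1 : {n : ℕ} (X : Vec Bool n) → countᵇ (pairSum≡ᵇ X 1) (pairs n) ≡ trues X * falses X
countᵇ-pairSum≡ᵇ1 [] = refl
countᵇ-pairSum≡ᵇ1 {suc n} (x ∷ X)
  rewrite pairs-suc n
        | countᵇ-++ (pairSum≡ᵇ (x ∷ X) 1) (map (λ k → zero , suc k) (allFin n)) (map liftPair (pairs n))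
        | countᵇ-map (pairSum≡ᵇ (x ∷ X) 1) (λ k → zero , suc k) (allFin n)
        | countᵇ-map (pairSum≡ᵇ (x ∷ X) 1) liftPair (pairs n)
        | countᵇ-pairSum≡ᵇ1 X
  with x
... | true  = cong (_+ trues X * falses X) (trans (countᵇ-lookup _ X) (countᵇ-cong b2n≡ᵇ0 (toList X)))
... | false = trans (cong (_+ trues X * falses X) (trans (countᵇ-lookup _ X) (countᵇ-cong b2n≡ᵇ1 (toList X))))
                    (sym (*-suc (trues X) (falses X)))

countᵇ-pairSum≡ᵇ2 : {n : ℕ} (X : Vec Bool n) → countᵇ (pairSum≡ᵇ X 2) (pairs n) ≡ choose2 (trues X)
countᵇ-pairSum≡ᵇ2 [] = refl
countᵇ-pairSum≡ᵇ2 {suc n} (x ∷ X)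
  rewrite pairs-suc n
        | countᵇ-++ (pairSum≡ᵇ (x ∷ X) 2) (map (λ k → zero , suc k) (allFin n)) (map liftPair (pairs n))
        | countᵇ-map (pairSum≡ᵇ (x ∷ X) 2) (λ k → zero , suc k) (allFin n)
        | countᵇ-map (pairSum≡ᵇ (x ∷ X) 2) liftPair (pairs n)
        | countᵇ-pairSum≡ᵇ2 X
  with x
... | true  = cong (_+ choose2 (trues X)) (trans (countᵇ-lookup _ X) (countᵇ-cong b2n≡ᵇ1 (toList X)))
... | false = cong (_+ choose2 (trues X)) (trans (countᵇ-lookup _ X)
                (trans (countᵇ-cong b2n≡ᵇ2 (toList X)) (countᵇ-const-false (toList X))))

-- The number of new edges {0, j+1, k+1} compatible with a partition with |X| = a and |Y| = f,
-- extended by putting the new vertex 0 into X (true) or into Y (false).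
extensionGain : Bool → ℕ → ℕ → ℕ
extensionGain true  a f = a * f
extensionGain false a f = choose2 a

countᵇ-exactlyTwoIn-withZero : {n : ℕ} (b : Bool) (X : Vec Bool n) →
  countᵇ (exactlyTwoIn (b ∷ X)) (map withZero (pairs n)) ≡ extensionGain b (trues X) (falses X)
countᵇ-exactlyTwoIn-withZero {n} true  X = trans (countᵇ-map (exactlyTwoIn (true ∷ X)) withZero (pairs n)) (countᵇ-pairSum≡ᵇ1 X)
countᵇ-exactlyTwoIn-withZero {n} false X = trans (countᵇ-map (exactlyTwoIn (false ∷ X)) withZero (pairs n)) (countᵇ-pairSum≡ᵇ2 X)

countᵇ-exactlyTwoIn : {n : ℕ} (X : Vec Bool n) → countᵇ (exactlyTwoIn X) (triples n) ≡ choose2 (trues X) * falses X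
countᵇ-exactlyTwoIn [] = refl
countᵇ-exactlyTwoIn {suc n} (x ∷ X) = begin
  countᵇ (exactlyTwoIn (x ∷ X)) (triples (suc n))
    ≡⟨ cong (countᵇ (exactlyTwoIn (x ∷ X))) (triples-suc n) ⟩
  countᵇ (exactlyTwoIn (x ∷ X)) (map withZero (pairs n) ++ map liftTriple (triples n))
    ≡⟨ countᵇ-++ (exactlyTwoIn (x ∷ X)) (map withZero (pairs n)) (map liftTriple (triples n)) ⟩
  countᵇ (exactlyTwoIn (x ∷ X)) (map withZero (pairs n)) + countᵇ (exactlyTwoIn (x ∷ X)) (map liftTriple (triples n))
    ≡⟨ cong₂ _+_ (countᵇ-exactlyTwoIn-withZero x X) (countᵇ-map (exactlyTwoIn (x ∷ X)) liftTriple (triples n)) ⟩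
  extensionGain x (trues X) (falses X) + countᵇ (exactlyTwoIn X) (triples n)
    ≡⟨ cong (extensionGain x (trues X) (falses X) +_) (countᵇ-exactlyTwoIn X) ⟩
  extensionGain x (trues X) (falses X) + choose2 (trues X) * falses X
    ≡⟨ step x ⟩
  choose2 (trues (x ∷ X)) * falses (x ∷ X) ∎
  where
  open ≡-Reasoning
  step : ∀ x → extensionGain x (trues X) (falses X) + choose2 (trues X) * falses X ≡ choose2 (trues (x ∷ X)) * falses (x ∷ X)
  step true  = sym (*-distribʳ-+ (falses X) (trues X) (choose2 (trues X)))
  step false = sym (*-suc (choose2 (trues X)) (falses X))

-- Bounds on S

∧-≡-true : {a b : Bool} → a ∧ b ≡ true → a ≡ true × b ≡ true
∧-≡-true {true} b≡true = refl , b≡true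

semiBipartite-intro : {n : ℕ} (X : Vec Bool n) (H : List (Triple n)) → all (exactlyTwoIn X) H ≡ true → semiBipartite H ≡ true
semiBipartite-intro X H = any-∈ (allVecs-complete X)

S-≥-compatible : {n : ℕ} (X : Vec Bool n) → 2 ^ (choose2 (trues X) * falses X) ≤ S n
S-≥-compatible {n} X = begin
  2 ^ (choose2 (trues X) * falses X)                    ≡⟨ cong (2 ^_) (countᵇ-exactlyTwoIn X) ⟨
  2 ^ countᵇ (exactlyTwoIn X) (triples n)               ≡⟨ countᵇ-all-sublists (exactlyTwoIn X) (triples n) ⟨
  countᵇ (all (exactlyTwoIn X)) (threeGraphs n)         ≤⟨ countᵇ-mono (semiBipartite-intro X) (threeGraphs n) ⟩
  S n                                                   ∎
  where open ≤-Reasoning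

semiBipartiteFor : {n : ℕ} → (Vec Bool n → Bool) → List (Triple n) → Bool
semiBipartiteFor {n} g H = any (λ X → g X ∧ all (exactlyTwoIn X) H) (allVecs n)

S-≤-good+bad : (n : ℕ) (g : Vec Bool n → Bool) →
  S n ≤ countᵇ (semiBipartiteFor g) (threeGraphs n) + countᵇ (semiBipartiteFor (not ∘ g)) (threeGraphs n)
S-≤-good+bad n g = ≤-trans (countᵇ-mono (λ H → any-split g (λ X → all (exactlyTwoIn X) H) (allVecs n)) (threeGraphs n))
                      (countᵇ-∨ (semiBipartiteFor g) (semiBipartiteFor (not ∘ g)) (threeGraphs n))

semiBipartiteFor-≤ : (n D : ℕ) (g : Vec Bool n → Bool) → (∀ X → g X ≡ true → choose2 (trues X) * falses X ≤ D) →
  countᵇ (semiBipartiteFor g) (threeGraphs n) ≤ 2 ^ n * 2 ^ D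
semiBipartiteFor-≤ n D g bound = begin
  countᵇ (semiBipartiteFor g) (threeGraphs n)
    ≤⟨ union-bound (allVecs n) ⟩
  sum (map (λ X → countᵇ (λ H → g X ∧ all (exactlyTwoIn X) H) (threeGraphs n)) (allVecs n))
    ≤⟨ sum-map-≤ _ (2 ^ D) each (allVecs n) ⟩
  length (allVecs n) * 2 ^ D
    ≡⟨ cong (_* 2 ^ D) (length-allVecs n) ⟩
  2 ^ n * 2 ^ D ∎
  where
  open ≤-Reasoning
  union-bound : (Xs : List (Vec Bool n)) →
    countᵇ (λ H → any (λ X → g X ∧ all (exactlyTwoIn X) H) Xs) (threeGraphs n)
      ≤ sum (map (λ X → countᵇ (λ H → g X ∧ all (exactlyTwoIn X) H) (threeGraphs n)) Xs)
  union-bound []       = ≤-reflexive (countᵇ-const-false (threeGraphs n))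
  union-bound (X ∷ Xs) = ≤-trans (countᵇ-∨ _ _ (threeGraphs n)) (+-monoʳ-≤ _ (union-bound Xs))
  each : ∀ X → countᵇ (λ H → g X ∧ all (exactlyTwoIn X) H) (threeGraphs n) ≤ 2 ^ D
  each X with g X in gX
  ... | false = ≤-trans (≤-reflexive (countᵇ-const-false (threeGraphs n))) z≤n
  ... | true  = begin
    countᵇ (all (exactlyTwoIn X)) (threeGraphs n)  ≡⟨ countᵇ-all-sublists (exactlyTwoIn X) (triples n) ⟩
    2 ^ countᵇ (exactlyTwoIn X) (triples n)       ≡⟨ cong (2 ^_) (countᵇ-exactlyTwoIn X) ⟩
    2 ^ (choose2 (trues X) * falses X)            ≤⟨ ^-monoʳ-≤ 2 (bound X gX) ⟩
    2 ^ D                                         ∎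

extensions : {n : ℕ} → List (Triple n) → ℕ
extensions {n} H = countᵇ (λ A → semiBipartite (A ++ map liftTriple H)) (sublists (map withZero (pairs n)))

S-suc≡sum-extensions : (n : ℕ) → S (suc n) ≡ sum (map extensions (threeGraphs n))
S-suc≡sum-extensions n = begin
  countᵇ semiBipartite (sublists (triples (suc n)))
    ≡⟨ cong (countᵇ semiBipartite ∘ sublists) (triples-suc n) ⟩
  countᵇ semiBipartite (sublists (new ++ map liftTriple (triples n)))
    ≡⟨ countᵇ-sublists-++ semiBipartite new (map liftTriple (triples n)) ⟩
  sum (map (λ B → countᵇ (λ A → semiBipartite (A ++ B)) (sublists new)) (sublists (map liftTriple (triples n))))
    ≡⟨ cong (sum ∘ map _) (sublists-map liftTriple (triples n)) ⟩
  sum (map (λ B → countᵇ (λ A → semiBipartite (A ++ B)) (sublists new)) (map (map liftTriple) (threeGraphs n)))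
    ≡⟨ cong sum (map-∘ (threeGraphs n)) ⟨
  sum (map extensions (threeGraphs n)) ∎
  where
  open ≡-Reasoning
  new = map withZero (pairs n)

all-exactlyTwoIn-liftTriple : {n : ℕ} (b : Bool) (X : Vec Bool n) (H : List (Triple n)) →
  all (exactlyTwoIn (b ∷ X)) (map liftTriple H) ≡ all (exactlyTwoIn X) H
all-exactlyTwoIn-liftTriple b X H = cong and (sym (map-∘ H))

extensions-≥ : {n : ℕ} (b : Bool) (X : Vec Bool n) (H : List (Triple n)) → all (exactlyTwoIn X) H ≡ true →
  2 ^ extensionGain b (trues X) (falses X) ≤ extensions H
extensions-≥ {n} b X H allowed = begin
  2 ^ extensionGain b (trues X) (falses X)                               ≡⟨ cong (2 ^_) (countᵇ-exactlyTwoIn-withZero b X) ⟨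
  2 ^ countᵇ (exactlyTwoIn (b ∷ X)) new               ≡⟨ countᵇ-all-sublists (exactlyTwoIn (b ∷ X)) new ⟨
  countᵇ (all (exactlyTwoIn (b ∷ X))) (sublists new)  ≤⟨ countᵇ-mono extend (sublists new) ⟩
  extensions H                                        ∎
  where
  open ≤-Reasoning
  new = map withZero (pairs n)
  extend : ∀ A → all (exactlyTwoIn (b ∷ X)) A ≡ true → semiBipartite (A ++ map liftTriple H) ≡ true
  extend A allowedA = semiBipartite-intro (b ∷ X) (A ++ map liftTriple H)
    (trans (all-++ (exactlyTwoIn (b ∷ X)) A (map liftTriple H))
           (cong₂ _∧_ allowedA (trans (all-exactlyTwoIn-liftTriple b X H) allowed)))

S-suc-≥ : (n E : ℕ) (g : Vec Bool n → Bool) → (∀ X → g X ≡ true → ∃ λ b → E ≤ extensionGain b (trues X) (falses X)) →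
  2 ^ E * countᵇ (semiBipartiteFor g) (threeGraphs n) ≤ S (suc n)
S-suc-≥ n E g gain = begin
  2 ^ E * countᵇ (semiBipartiteFor g) (threeGraphs n)  ≤⟨ sum-map-≥ extensions (semiBipartiteFor g) (2 ^ E) bound (threeGraphs n) ⟩
  sum (map extensions (threeGraphs n))                  ≡⟨ S-suc≡sum-extensions n ⟨
  S (suc n)                                             ∎
  where
  open ≤-Reasoning
  bound : ∀ H → semiBipartiteFor g H ≡ true → 2 ^ E ≤ extensions H
  bound H sb with any-witness _ (allVecs n) sb
  ... | X , gX∧allowed with ∧-≡-true gX∧allowed
  ... | gX , allowed with gain X gX
  ... | b , E≤gain = ≤-trans (^-monoʳ-≤ 2 E≤gain) (extensions-≥ b X H allowed)

≤-by-slack : ∀ {x y} s → x + s ≡ y → x ≤ y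
≤-by-slack {x} s x+s≡y = subst (x ≤_) x+s≡y (m≤m+n x s)

^2≡ : ∀ n → n ^ 2 ≡ n * n
^2≡ n = cong (n *_) (*-identityʳ n)

^3≡ : ∀ n → n ^ 3 ≡ n * (n * n)
^3≡ n = cong (n *_) (^2≡ n)

2*choose2+n≡n*n : ∀ a → 2 * choose2 a + a ≡ a * a
2*choose2+n≡n*n zero    = refl
2*choose2+n≡n*n (suc a) = begin
  2 * (a + choose2 a) + suc a  ≡⟨ lemma a (choose2 a) ⟩
  (2 * choose2 a + a) + 2 * a + 1  ≡⟨ cong (λ x → x + 2 * a + 1) (2*choose2+n≡n*n a) ⟩
  a * a + 2 * a + 1            ≡⟨ square a ⟩
  suc a * suc a                ∎
  where
  open ≡-Reasoning
  lemma : ∀ a c → 2 * (a + c) + suc a ≡ (2 * c + a) + 2 * a + 1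
  lemma = solve-∀
  square : ∀ a → a * a + 2 * a + 1 ≡ suc a * suc a
  square = solve-∀

⌈_/_⌉ : ℕ → (d : ℕ) → .{{NonZero d}} → ℕ
⌈ k / d ⌉ = (k + pred d) / d

≤⌈/⌉* : ∀ k d .{{_ : NonZero d}} → k ≤ ⌈ k / d ⌉ * d
≤⌈/⌉* k d@(suc m) = +-cancelʳ-≤ m k (⌈ k / d ⌉ * d) (begin
  k + m                       ≡⟨ m≡m%n+[m/n]*n (k + m) d ⟩
  (k + m) % d + ⌈ k / d ⌉ * d ≤⟨ +-monoˡ-≤ (⌈ k / d ⌉ * d) (<⇒≤pred (m%n<n (k + m) d)) ⟩
  m + ⌈ k / d ⌉ * d           ≡⟨ +-comm m (⌈ k / d ⌉ * d) ⟩
  ⌈ k / d ⌉ * d + m           ∎)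
  where open ≤-Reasoning

⌈/⌉-least : ∀ {k e} d .{{_ : NonZero d}} → k ≤ e * d → ⌈ k / d ⌉ ≤ e
⌈/⌉-least {k} {e} d@(suc m) k≤e*d = <⇒≤pred (m<n*o⇒m/o<n {k + m} {suc e} (begin-strict
  k + m      <⟨ +-monoʳ-< k (n<1+n m) ⟩
  k + d      ≤⟨ +-monoˡ-≤ d k≤e*d ⟩
  e * d + d  ≡⟨ +-comm (e * d) d ⟩
  suc e * d  ∎))
  where open ≤-Reasoning

mod3-cases : ∀ n → ∃ λ q → n ≡ 3 * q ⊎ n ≡ 3 * q + 1 ⊎ n ≡ 3 * q + 2
mod3-cases zero = 0 , inj₁ refl
mod3-cases (suc n) with mod3-cases n
... | q , inj₁ refl        = q , inj₂ (inj₁ (+-comm 1 (3 * q)))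
... | q , inj₂ (inj₁ refl) = q , inj₂ (inj₂ (lemma q))
  where lemma : ∀ q → suc (3 * q + 1) ≡ 3 * q + 2
        lemma = solve-∀
... | q , inj₂ (inj₂ refl) = suc q , inj₁ (lemma q)
  where lemma : ∀ q → suc (3 * q + 2) ≡ 3 * suc q
        lemma = solve-∀

halve-balanced : ∀ n a f → 4 * (n * (n * n)) + 27 * a * f ≤ 27 * (a * a) * f + 6 * (n * n) + 6 * n →
  2 * (n * (n * n)) ≤ 27 * (choose2 a * f) + (3 * (n * n) + 3 * n)
halve-balanced n a f doubled = *-cancelˡ-≤ 2 (+-cancelʳ-≤ (27 * a * f) _ _ (begin
  2 * (2 * (n * (n * n))) + 27 * a * f                  ≡⟨ lhs n a f ⟩
  4 * (n * (n * n)) + 27 * a * f                        ≤⟨ doubled ⟩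
  27 * (a * a) * f + 6 * (n * n) + 6 * n                ≡⟨ cong (λ x → 27 * x * f + 6 * (n * n) + 6 * n) (2*choose2+n≡n*n a) ⟨
  27 * (2 * choose2 a + a) * f + 6 * (n * n) + 6 * n    ≡⟨ rhs n a f (choose2 a) ⟩
  2 * (27 * (choose2 a * f) + (3 * (n * n) + 3 * n)) + 27 * a * f ∎))
  where
  open ≤-Reasoning
  lhs : ∀ n a f → 2 * (2 * (n * (n * n))) + 27 * a * f ≡ 4 * (n * (n * n)) + 27 * a * f
  lhs = solve-∀
  rhs : ∀ n a f c → 27 * (2 * c + a) * f + 6 * (n * n) + 6 * n ≡ 2 * (27 * (c * f) + (3 * (n * n) + 3 * n)) + 27 * a * f
  rhs = solve-∀

-- |X| ≈ 2n/3 maximises C(|X|, 2)·|Y|.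
balanced-split : ∀ n → ∃₂ λ a f → a + f ≡ n × 2 * (n * (n * n)) ≤ 27 * (choose2 a * f) + (3 * (n * n) + 3 * n)
balanced-split n with mod3-cases n
... | q , inj₁ refl = 2 * q , q , a+f≡n q , halve-balanced (3 * q) (2 * q) q (≤-by-slack (18 * q) (lemma q))
  where a+f≡n : ∀ q → 2 * q + q ≡ 3 * q
        a+f≡n = solve-∀
        lemma : ∀ q → 4 * (3 * q * (3 * q * (3 * q))) + 27 * (2 * q) * q + 18 * q
                    ≡ 27 * (2 * q * (2 * q)) * q + 6 * (3 * q * (3 * q)) + 6 * (3 * q)
        lemma = solve-∀
... | q , inj₂ (inj₁ refl) = 2 * q + 1 , q , a+f≡n q , halve-balanced (3 * q + 1) (2 * q + 1) q (≤-by-slack (18 * q + 8) (lemma q))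
  where a+f≡n : ∀ q → 2 * q + 1 + q ≡ 3 * q + 1
        a+f≡n = solve-∀
        lemma : ∀ q → 4 * ((3 * q + 1) * ((3 * q + 1) * (3 * q + 1))) + 27 * (2 * q + 1) * q + (18 * q + 8)
                    ≡ 27 * ((2 * q + 1) * (2 * q + 1)) * q + 6 * ((3 * q + 1) * (3 * q + 1)) + 6 * (3 * q + 1)
        lemma = solve-∀
... | q , inj₂ (inj₂ refl) = 2 * q + 1 , q + 1 , a+f≡n q , halve-balanced (3 * q + 2) (2 * q + 1) (q + 1) (≤-by-slack 4 (lemma q))
  where a+f≡n : ∀ q → 2 * q + 1 + (q + 1) ≡ 3 * q + 2
        a+f≡n = solve-∀
        lemma : ∀ q → 4 * ((3 * q + 2) * ((3 * q + 2) * (3 * q + 2))) + 27 * (2 * q + 1) * (q + 1) + 4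
                    ≡ 27 * ((2 * q + 1) * (2 * q + 1)) * (q + 1) + 6 * ((3 * q + 2) * (3 * q + 2)) + 6 * (3 * q + 2)
        lemma = solve-∀

halve-choose2 : ∀ n a → 2 * (2 * (n * n)) + 9 * a ≤ 9 * (a * a) + 2 * n + 2 → 2 * (n * n) ≤ 9 * choose2 a + n + 1
halve-choose2 n a doubled = *-cancelˡ-≤ 2 (+-cancelʳ-≤ (9 * a) _ _ (begin
  2 * (2 * (n * n)) + 9 * a            ≤⟨ doubled ⟩
  9 * (a * a) + 2 * n + 2              ≡⟨ cong (λ x → 9 * x + 2 * n + 2) (2*choose2+n≡n*n a) ⟨
  9 * (2 * choose2 a + a) + 2 * n + 2  ≡⟨ lemma n a (choose2 a) ⟩
  2 * (9 * choose2 a + n + 1) + 9 * a  ∎))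
  where
  open ≤-Reasoning
  lemma : ∀ n a c → 9 * (2 * c + a) + 2 * n + 2 ≡ 2 * (9 * c + n + 1) + 9 * a
  lemma = solve-∀

-- 9af − 2(a+f)² = (2a − f)(2f − a), so putting the new vertex into X wins while a ≤ 2f + 1; beyond that Y wins.
good-gain : ∀ a f → f ≤ 2 * a → ∃ λ b → 2 * ((a + f) * (a + f)) ≤ 9 * extensionGain b a f + (a + f) + 1
good-gain a f f≤2a with ≤-total a f
... | inj₁ a≤f with m≤n⇒∃[o]m+o≡n a≤f
...   | d , refl with m≤n⇒∃[o]m+o≡n (+-cancelˡ-≤ a d a (subst (a + d ≤_) (cong (a +_) (+-identityʳ a)) f≤2a))
...     | w , refl = true , ≤-by-slack (3 * (d * w) + w * w + (d + w + (d + w + d)) + 1) (lemma d w)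
  where lemma : ∀ d w → let a = d + w; f = d + w + d in
                  2 * ((a + f) * (a + f)) + (3 * (d * w) + w * w + (a + f) + 1) ≡ 9 * (a * f) + (a + f) + 1
        lemma = solve-∀
good-gain a f f≤2a | inj₂ f≤a with m≤n⇒∃[o]m+o≡n f≤a
... | d , refl with d ≤? f
...   | yes d≤f with m≤n⇒∃[o]m+o≡n d≤f
...     | w , refl = true , ≤-by-slack (3 * (d * w) + w * w + (d + w + d + (d + w)) + 1) (lemma d w)
  where lemma : ∀ d w → let a = d + w + d; f = d + w in
                  2 * ((a + f) * (a + f)) + (3 * (d * w) + w * w + (a + f) + 1) ≡ 9 * (a * f) + (a + f) + 1
        lemma = solve-∀
good-gain a f f≤2a | inj₂ f≤a | d , refl | no d≰f with m≤n⇒∃[o]m+o≡n (≰⇒> d≰f)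
... | zero , refl = true , ≤-reflexive (lemma f)
  where lemma : ∀ f → 2 * ((f + (suc f + 0) + f) * (f + (suc f + 0) + f)) ≡ 9 * ((f + (suc f + 0)) * f) + (f + (suc f + 0) + f) + 1
        lemma = solve-∀
... | suc e , refl = false , halve-choose2 (f + (suc f + suc e) + f) (f + (suc f + suc e)) (≤-by-slack (12 * f * (e + 1) + (5 * e + 8) * (e + 1)) (lemma f e))
  where lemma : ∀ f e → let a = f + (suc f + suc e) in
                  2 * (2 * ((a + f) * (a + f))) + 9 * a + (12 * f * (e + 1) + (5 * e + 8) * (e + 1)) ≡ 9 * (a * a) + 2 * (a + f) + 2
        lemma = solve-∀

bad-choose2 : ∀ a f → 2 * a ≤ f → 18 * (choose2 a * f) ≤ (a + f) * ((a + f) * (a + f))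
bad-choose2 a f 2a≤f with m≤n⇒∃[o]m+o≡n 2a≤f
... | t , refl = begin
  18 * (choose2 a * (2 * a + t))                      ≤⟨ m≤m+n _ (9 * a * (2 * a + t)) ⟩
  18 * (choose2 a * (2 * a + t)) + 9 * a * (2 * a + t) ≡⟨ lemma₁ a t (choose2 a) ⟩
  9 * (2 * choose2 a + a) * (2 * a + t)               ≡⟨ cong (λ x → 9 * x * (2 * a + t)) (2*choose2+n≡n*n a) ⟩
  9 * (a * a) * (2 * a + t)                           ≤⟨ ≤-by-slack (9 * (a * (a * a)) + 18 * (a * a) * t + 9 * a * (t * t) + t * (t * t)) (lemma₂ a t) ⟩
  (a + (2 * a + t)) * ((a + (2 * a + t)) * (a + (2 * a + t))) ∎
  where
  open ≤-Reasoning
  lemma₁ : ∀ a t c → 18 * (c * (2 * a + t)) + 9 * a * (2 * a + t) ≡ 9 * (2 * c + a) * (2 * a + t)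
  lemma₁ = solve-∀
  lemma₂ : ∀ a t → 9 * (a * a) * (2 * a + t) + (9 * (a * (a * a)) + 18 * (a * a) * t + 9 * a * (t * t) + t * (t * t))
                 ≡ (a + (2 * a + t)) * ((a + (2 * a + t)) * (a + (2 * a + t)))
  lemma₂ = solve-∀

≤-offset-elim : ∀ {m n} (P : ℕ → Set) → m ≤ n → (∀ o → P (m + o)) → P n
≤-offset-elim P m≤n P[m+_] = subst P (proj₂ (m≤n⇒∃[o]m+o≡n m≤n)) (P[m+_] _)

bad-margin : ∀ n c d → 13 ≤ n → 2 * (n * (n * n)) ≤ 27 * c + (3 * (n * n) + 3 * n) → 18 * d ≤ n * (n * n) →
  d + (4 + n) ≤ c
bad-margin n c d 13≤n balanced small = *-cancelˡ-≤ 54 (+-cancelʳ-≤ (6 * (n * n) + 6 * n) _ _ (begin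
  54 * (d + (4 + n)) + (6 * (n * n) + 6 * n)               ≡⟨ lemma₁ n d ⟩
  3 * (18 * d) + (216 + 54 * n + 6 * (n * n) + 6 * n)      ≤⟨ +-monoˡ-≤ _ (*-monoʳ-≤ 3 small) ⟩
  3 * (n * (n * n)) + (216 + 54 * n + 6 * (n * n) + 6 * n) ≤⟨ ≤-offset-elim CubicDominates 13≤n cubic-dominates ⟩
  2 * (2 * (n * (n * n)))                                  ≤⟨ *-monoʳ-≤ 2 balanced ⟩
  2 * (27 * c + (3 * (n * n) + 3 * n))                     ≡⟨ lemma₂ n c ⟩
  54 * c + (6 * (n * n) + 6 * n)                           ∎))
  where
  open ≤-Reasoning
  lemma₁ : ∀ n d → 54 * (d + (4 + n)) + (6 * (n * n) + 6 * n) ≡ 3 * (18 * d) + (216 + 54 * n + 6 * (n * n) + 6 * n)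
  lemma₁ = solve-∀
  lemma₂ : ∀ n c → 2 * (27 * c + (3 * (n * n) + 3 * n)) ≡ 54 * c + (6 * (n * n) + 6 * n)
  lemma₂ = solve-∀
  -- that is, n³ ≥ 6n² + 60n + 216, which holds from n = 13 on
  CubicDominates : ℕ → Set
  CubicDominates n = 3 * (n * (n * n)) + (216 + 54 * n + 6 * (n * n) + 6 * n) ≤ 2 * (2 * (n * (n * n)))
  cubic-dominates : ∀ o → CubicDominates (13 + o)
  cubic-dominates o = ≤-by-slack (187 + 291 * o + 33 * (o * o) + o * (o * o)) (lemma₃ o)
    where lemma₃ : ∀ o → let n = 13 + o in
                     3 * (n * (n * n)) + (216 + 54 * n + 6 * (n * n) + 6 * n) + (187 + 291 * o + 33 * (o * o) + o * (o * o))
                       ≡ 2 * (2 * (n * (n * n)))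
          lemma₃ = solve-∀

-- Growth of S

^-distribʳ-* : ∀ x y k → (x * y) ^ k ≡ x ^ k * y ^ k
^-distribʳ-* x y zero    = refl
^-distribʳ-* x y (suc k) = trans (cong (x * y *_) (^-distribʳ-* x y k)) (*-interchange x y (x ^ k) (y ^ k))

2^-shift : ∀ x y a b z {a′ b′} → a + z ≡ a′ → b + z ≡ b′ → x * 2 ^ a ≤ y * 2 ^ b → x * 2 ^ a′ ≤ y * 2 ^ b′
2^-shift x y a b z refl refl x2ᵃ≤y2ᵇ = begin
  x * 2 ^ (a + z)    ≡⟨ cong (x *_) (^-distribˡ-+-* 2 a z) ⟩
  x * (2 ^ a * 2 ^ z) ≡⟨ *-assoc x (2 ^ a) (2 ^ z) ⟨
  x * 2 ^ a * 2 ^ z  ≤⟨ *-monoˡ-≤ (2 ^ z) x2ᵃ≤y2ᵇ ⟩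
  y * 2 ^ b * 2 ^ z  ≡⟨ *-assoc y (2 ^ b) (2 ^ z) ⟩
  y * (2 ^ b * 2 ^ z) ≡⟨ cong (y *_) (^-distribˡ-+-* 2 b z) ⟨
  y * 2 ^ (b + z)    ∎
  where open ≤-Reasoning

≤ᵇ≡true⇒≤ : ∀ {m n} → (m ≤ᵇ n) ≡ true → m ≤ n
≤ᵇ≡true⇒≤ {m} {n} m≤ᵇn = ≤ᵇ⇒≤ m n (subst T (sym m≤ᵇn) tt)

not-≤ᵇ≡true⇒> : ∀ {m n} → not (m ≤ᵇ n) ≡ true → n < m
not-≤ᵇ≡true⇒> {m} {n} not-m≤ᵇn with m ≤ᵇ n in m≤ᵇn
not-≤ᵇ≡true⇒> {m} {n} ()       | true
not-≤ᵇ≡true⇒> {m} {n} refl     | false = ≰⇒> (λ m≤n → subst T m≤ᵇn (≤⇒≤ᵇ m≤n))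

trues-replicate : ∀ a f → trues (replicate a true ++ᵛ replicate f false) ≡ a
trues-replicate zero    zero    = refl
trues-replicate zero    (suc f) = trues-replicate zero f
trues-replicate (suc a) f       = cong suc (trues-replicate a f)

falses-replicate : ∀ a f → falses (replicate a true ++ᵛ replicate f false) ≡ f
falses-replicate zero    zero    = refl
falses-replicate zero    (suc f) = cong suc (falses-replicate zero f)
falses-replicate (suc a) f       = falses-replicate a f

S-≥-sizes : ∀ a f → 2 ^ (choose2 a * f) ≤ S (a + f)
S-≥-sizes a f = subst (λ x → 2 ^ x ≤ S (a + f))
  (cong₂ (λ a′ f′ → choose2 a′ * f′) (trues-replicate a f) (falses-replicate a f))
  (S-≥-compatible (replicate a true ++ᵛ replicate f false))

S-lower-bound : (n : ℕ) → 2 ^ (2 * n ^ 3) ≤ S n ^ 27 * 2 ^ (3 * n ^ 2 + 3 * n)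
S-lower-bound n with balanced-split n
... | a , f , refl , balanced = begin
  2 ^ (2 * n ^ 3)                             ≡⟨ cong (λ x → 2 ^ (2 * x)) (^3≡ n) ⟩
  2 ^ (2 * (n * (n * n)))                     ≤⟨ ^-monoʳ-≤ 2 balanced ⟩
  2 ^ (27 * c + (3 * (n * n) + 3 * n))        ≡⟨ cong (λ x → 2 ^ (27 * c + (3 * x + 3 * n))) (^2≡ n) ⟨
  2 ^ (27 * c + r)                            ≡⟨ ^-distribˡ-+-* 2 (27 * c) r ⟩
  2 ^ (27 * c) * 2 ^ r                        ≡⟨ cong (λ x → 2 ^ x * 2 ^ r) (*-comm 27 c) ⟩
  2 ^ (c * 27) * 2 ^ r                        ≡⟨ cong (_* 2 ^ r) (^-*-assoc 2 c 27) ⟨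
  (2 ^ c) ^ 27 * 2 ^ r                        ≤⟨ *-monoˡ-≤ (2 ^ r) (^-monoˡ-≤ 27 (S-≥-sizes a f)) ⟩
  S n ^ 27 * 2 ^ r                            ∎
  where
  open ≤-Reasoning
  c = choose2 a * f
  r = 3 * n ^ 2 + 3 * n

good : {n : ℕ} → Vec Bool n → Bool
good X = falses X ≤ᵇ 2 * trues X

gainExponent : ℕ → ℕ
gainExponent n = ⌈ 2 * (n * n) ∸ (n + 1) / 9 ⌉

good-extension : (n : ℕ) (X : Vec Bool n) → good X ≡ true → ∃ λ b → gainExponent n ≤ extensionGain b (trues X) (falses X)
good-extension n X goodX with good-gain (trues X) (falses X) (≤ᵇ≡true⇒≤ goodX)
... | b , gain rewrite trues+falses X =
  b , ⌈/⌉-least 9 (m≤n+o⇒m∸n≤o (2 * (n * n)) (n + 1) (≤-trans gain (≤-reflexive (lemma n (extensionGain b (trues X) (falses X))))))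
  where lemma : ∀ n g → 9 * g + n + 1 ≡ n + 1 + g * 9
        lemma = solve-∀

few-bad : (n : ℕ) → 13 ≤ n → 16 * countᵇ (semiBipartiteFor (not ∘ good)) (threeGraphs n) ≤ S n
few-bad n 13≤n with balanced-split n
... | a , f , refl , balanced = begin
  16 * countᵇ (semiBipartiteFor (not ∘ good)) (threeGraphs n) ≤⟨ *-monoʳ-≤ 16 (semiBipartiteFor-≤ n D (not ∘ good) bad-bound) ⟩
  16 * (2 ^ n * 2 ^ D)                                        ≡⟨ cong (16 *_) (^-distribˡ-+-* 2 n D) ⟨
  16 * 2 ^ (n + D)                                             ≡⟨ ^-distribˡ-+-* 2 4 (n + D) ⟨
  2 ^ (4 + (n + D))                                            ≡⟨ cong (2 ^_) (+-assoc 4 n D) ⟨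
  2 ^ (4 + n + D)                                              ≡⟨ cong (2 ^_) (m+[n∸m]≡n (≤-trans (m≤n+m (4 + n) 0) (bad-margin n c 0 13≤n balanced z≤n))) ⟩
  2 ^ c                                                        ≤⟨ S-≥-sizes a f ⟩
  S n                                                          ∎
  where
  open ≤-Reasoning
  c = choose2 a * f
  -- chosen so that 16 · 2ⁿ · 2ᴰ = 2ᶜ
  D = c ∸ (4 + n)
  bad-bound : ∀ X → not (good X) ≡ true → choose2 (trues X) * falses X ≤ D
  bad-bound X notGood = m+n≤o⇒m≤o∸n _ (bad-margin n c _ 13≤n balanced
    (subst (λ m → 18 * (choose2 (trues X) * falses X) ≤ m * (m * m)) (trues+falses X)
      (bad-choose2 (trues X) (falses X) (<⇒≤ (not-≤ᵇ≡true⇒> notGood)))))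

-- 15 s ≤ 16 g, and (16/15)⁹ < 2.
ninth-power-bound : ∀ {s g b} → s ≤ g + b → 16 * b ≤ s → s ^ 9 ≤ 2 * g ^ 9
ninth-power-bound {s} {g} {b} s≤g+b 16b≤s = *-cancelˡ-≤ (16 ^ 9) (begin
  16 ^ 9 * s ^ 9        ≤⟨ *-monoˡ-≤ (s ^ 9) (≤ᵇ⇒≤ (16 ^ 9) (2 * 15 ^ 9) tt) ⟩
  2 * 15 ^ 9 * s ^ 9    ≡⟨ trans (*-assoc 2 (15 ^ 9) (s ^ 9)) (cong (2 *_) (sym (^-distribʳ-* 15 s 9))) ⟩
  2 * (15 * s) ^ 9      ≤⟨ *-monoʳ-≤ 2 (^-monoˡ-≤ 9 15s≤16g) ⟩
  2 * (16 * g) ^ 9      ≡⟨ cong (2 *_) (^-distribʳ-* 16 g 9) ⟩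
  2 * (16 ^ 9 * g ^ 9)  ≡⟨ *-comm 2 (16 ^ 9 * g ^ 9) ⟩
  16 ^ 9 * g ^ 9 * 2    ≡⟨ *-assoc (16 ^ 9) (g ^ 9) 2 ⟩
  16 ^ 9 * (g ^ 9 * 2)  ≡⟨ cong (16 ^ 9 *_) (*-comm (g ^ 9) 2) ⟩
  16 ^ 9 * (2 * g ^ 9)  ∎)
  where
  open ≤-Reasoning
  15s≤16g : 15 * s ≤ 16 * g
  15s≤16g = +-cancelʳ-≤ s (15 * s) (16 * g) (begin
    15 * s + s       ≡⟨ +-comm (15 * s) s ⟩
    16 * s           ≤⟨ *-monoʳ-≤ 16 s≤g+b ⟩
    16 * (g + b)     ≡⟨ *-distribˡ-+ 16 g b ⟩
    16 * g + 16 * b  ≤⟨ +-monoʳ-≤ (16 * g) 16b≤s ⟩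
    16 * g + s       ∎)

growth-from-counts : ∀ {s s′} g b E p q → s ≤ g + b → 16 * b ≤ s → 2 ^ E * g ≤ s′ → suc p ≤ 9 * E + q →
  s ^ 9 * 2 ^ p ≤ s′ ^ 9 * 2 ^ q
growth-from-counts {s} {s′} g b E p q s≤g+b 16b≤s 2ᴱg≤s′ p<9E+q = begin
  s ^ 9 * 2 ^ p                ≤⟨ *-monoˡ-≤ (2 ^ p) (ninth-power-bound {s} {g} {b} s≤g+b 16b≤s) ⟩
  2 * g ^ 9 * 2 ^ p            ≡⟨ lemma₁ (g ^ 9) (2 ^ p) ⟩
  g ^ 9 * 2 ^ suc p            ≤⟨ *-monoʳ-≤ (g ^ 9) (^-monoʳ-≤ 2 p<9E+q) ⟩
  g ^ 9 * 2 ^ (9 * E + q)      ≡⟨ cong (g ^ 9 *_) (^-distribˡ-+-* 2 (9 * E) q) ⟩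
  g ^ 9 * (2 ^ (9 * E) * 2 ^ q) ≡⟨ cong (λ x → g ^ 9 * (2 ^ x * 2 ^ q)) (*-comm 9 E) ⟩
  g ^ 9 * (2 ^ (E * 9) * 2 ^ q) ≡⟨ cong (λ x → g ^ 9 * (x * 2 ^ q)) (^-*-assoc 2 E 9) ⟨
  g ^ 9 * ((2 ^ E) ^ 9 * 2 ^ q) ≡⟨ lemma₂ (g ^ 9) ((2 ^ E) ^ 9) (2 ^ q) ⟩
  (2 ^ E) ^ 9 * g ^ 9 * 2 ^ q  ≡⟨ cong (_* 2 ^ q) (^-distribʳ-* (2 ^ E) g 9) ⟨
  (2 ^ E * g) ^ 9 * 2 ^ q      ≤⟨ *-monoˡ-≤ (2 ^ q) (^-monoˡ-≤ 9 2ᴱg≤s′) ⟩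
  s′ ^ 9 * 2 ^ q               ∎
  where
  open ≤-Reasoning
  lemma₁ : ∀ x y → 2 * x * y ≡ x * (2 * y)
  lemma₁ = solve-∀
  lemma₂ : ∀ x y z → x * (y * z) ≡ y * x * z
  lemma₂ = solve-∀

S-growth : ∀ n → 13 ≤ n → S n ^ 9 * 2 ^ (2 * suc n ^ 2 + 1) ≤ S (suc n) ^ 9 * 2 ^ (5 * suc n)
S-growth n 13≤n = growth-from-counts goodGraphs badGraphs E (2 * suc n ^ 2 + 1) (5 * suc n)
  (S-≤-good+bad n good) (few-bad n 13≤n) (S-suc-≥ n E good (good-extension n)) exponent
  where
  open ≤-Reasoning
  E = gainExponent n
  goodGraphs = countᵇ (semiBipartiteFor good) (threeGraphs n)
  badGraphs  = countᵇ (semiBipartiteFor (not ∘ good)) (threeGraphs n)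
  lemma₁ : ∀ n → suc (2 * (suc n * suc n) + 1) ≡ 2 * (n * n) + (4 * n + 4)
  lemma₁ = solve-∀
  lemma₂ : ∀ n e → n + 1 + e * 9 + (4 * n + 4) ≡ 9 * e + 5 * suc n
  lemma₂ = solve-∀
  exponent : suc (2 * suc n ^ 2 + 1) ≤ 9 * E + 5 * suc n
  exponent = begin
    suc (2 * suc n ^ 2 + 1)        ≡⟨ cong (λ x → suc (2 * x + 1)) (^2≡ (suc n)) ⟩
    suc (2 * (suc n * suc n) + 1)  ≡⟨ lemma₁ n ⟩
    2 * (n * n) + (4 * n + 4)      ≤⟨ +-monoˡ-≤ (4 * n + 4) (≤-trans (m≤n+m∸n (2 * (n * n)) (n + 1))
                                                                      (+-monoʳ-≤ (n + 1) (≤⌈/⌉* (2 * (n * n) ∸ (n + 1)) 9))) ⟩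
    n + 1 + E * 9 + (4 * n + 4)    ≡⟨ lemma₂ n E ⟩
    9 * E + 5 * suc n              ∎

S-growth-chain : ∀ k → 13 ≤ k → let n = 3 + k in
    (S (n ∸ 1) ^ 9 * 2 ^ (2 * n ^ 2 + 1) ≤ S n ^ 9 * 2 ^ (5 * n))
  × (S (n ∸ 2) ^ 9 * 2 ^ (4 * n ^ 2 + 9) ≤ S (n ∸ 1) ^ 9 * 2 ^ (2 * n ^ 2 + 9 * n + 1))
  × (S (n ∸ 3) ^ 9 * 2 ^ (6 * n ^ 2 + 28) ≤ S (n ∸ 2) ^ 9 * 2 ^ (4 * n ^ 2 + 13 * n + 9))
S-growth-chain k 13≤k =
    S-growth (2 + k) (≤-trans 13≤k (m≤n+m k 2))
  , step₂
  , step₃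
  where
  e₁ : 2 * (2 + k) ^ 2 + 1 + (2 * (3 + k) ^ 2 + 4 * (3 + k) + 6) ≡ 4 * (3 + k) ^ 2 + 9
  e₁ = lemma k
    where lemma : ∀ k → 2 * ((2 + k) * ((2 + k) * 1)) + 1 + (2 * ((3 + k) * ((3 + k) * 1)) + 4 * (3 + k) + 6)
                      ≡ 4 * ((3 + k) * ((3 + k) * 1)) + 9
          lemma = solve-∀
  e₂ : 5 * (2 + k) + (2 * (3 + k) ^ 2 + 4 * (3 + k) + 6) ≡ 2 * (3 + k) ^ 2 + 9 * (3 + k) + 1
  e₂ = lemma k
    where lemma : ∀ k → 5 * (2 + k) + (2 * ((3 + k) * ((3 + k) * 1)) + 4 * (3 + k) + 6)
                      ≡ 2 * ((3 + k) * ((3 + k) * 1)) + 9 * (3 + k) + 1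
          lemma = solve-∀
  e₃ : 2 * (1 + k) ^ 2 + 1 + (4 * (3 + k) ^ 2 + 8 * (3 + k) + 19) ≡ 6 * (3 + k) ^ 2 + 28
  e₃ = lemma k
    where lemma : ∀ k → 2 * ((1 + k) * ((1 + k) * 1)) + 1 + (4 * ((3 + k) * ((3 + k) * 1)) + 8 * (3 + k) + 19)
                      ≡ 6 * ((3 + k) * ((3 + k) * 1)) + 28
          lemma = solve-∀
  e₄ : 5 * (1 + k) + (4 * (3 + k) ^ 2 + 8 * (3 + k) + 19) ≡ 4 * (3 + k) ^ 2 + 13 * (3 + k) + 9
  e₄ = lemma k
    where lemma : ∀ k → 5 * (1 + k) + (4 * ((3 + k) * ((3 + k) * 1)) + 8 * (3 + k) + 19)
                      ≡ 4 * ((3 + k) * ((3 + k) * 1)) + 13 * (3 + k) + 9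
          lemma = solve-∀
  step₂ : S (1 + k) ^ 9 * 2 ^ (4 * (3 + k) ^ 2 + 9) ≤ S (2 + k) ^ 9 * 2 ^ (2 * (3 + k) ^ 2 + 9 * (3 + k) + 1)
  step₂ = 2^-shift (S (1 + k) ^ 9) (S (2 + k) ^ 9) (2 * (2 + k) ^ 2 + 1) (5 * (2 + k)) (2 * (3 + k) ^ 2 + 4 * (3 + k) + 6) e₁ e₂
                    (S-growth (1 + k) (≤-trans 13≤k (m≤n+m k 1)))
  step₃ : S k ^ 9 * 2 ^ (6 * (3 + k) ^ 2 + 28) ≤ S (1 + k) ^ 9 * 2 ^ (4 * (3 + k) ^ 2 + 13 * (3 + k) + 9)
  step₃ = 2^-shift (S k ^ 9) (S (1 + k) ^ 9) (2 * (1 + k) ^ 2 + 1) (5 * (1 + k)) (4 * (3 + k) ^ 2 + 8 * (3 + k) + 19) e₃ e₄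
                    (S-growth k 13≤k)

lemma15 : ((n : ℕ) → 2 ^ (2 * n ^ 3) ≤ S n ^ 27 * 2 ^ (3 * n ^ 2 + 3 * n))
    × ∃ (λ n₀ → (n : ℕ) → n₀ ≤ n →
        (S (n ∸ 1) ^ 9 * 2 ^ (2 * n ^ 2 + 1) ≤ S n ^ 9 * 2 ^ (5 * n))
        × (S (n ∸ 2) ^ 9 * 2 ^ (4 * n ^ 2 + 9) ≤ S (n ∸ 1) ^ 9 * 2 ^ (2 * n ^ 2 + 9 * n + 1))
        × (S (n ∸ 3) ^ 9 * 2 ^ (6 * n ^ 2 + 28) ≤ S (n ∸ 2) ^ 9 * 2 ^ (4 * n ^ 2 + 13 * n + 9)))
lemma15 = S-lower-bound , 16 , λ { (suc (suc (suc k))) (s≤s (s≤s (s≤s 13≤k))) → S-growth-chain k 13≤k }
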